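{- The topology $\tau$ on $H$ is stronger than the topology $H$ inherits from the product topology of $2^\omega$. Consequently, every subset of $H$ that is Borel in the inherited product topology is Borel with respect to $\tau$.
   Context: $2^\omega$ carries coordinatewise addition mod 2, written $+$; the same $+$ denotes coordinatewise addition mod 2 of 0-1 sequences with the same domain. For sequences, $s\vartriangleleft t$ means $t$ properly extends $s$. Fix integers $0=n_0<n_1<n_2<\cdots$ and sets $C_i\subseteq 2^{[n_i,n_{i+1})}$ ($i\in\omega$) such that for every $i$ and all $s_0,\dots,s_{n_i}\in 2^{[n_i,n_{i+1})}$ both $\bigcap_{k\le n_i}(C_i+s_k)$ and $\bigcap_{k\le n_i}((2^{[n_i,n_{i+1})}\setminus C_i)+s_k)$ are nonempty. Let $H=\{x\in2^\omega: x\upharpoonright[n_i,n_{i+1})\in C_i\text{ for all }i\}$. Fix a sequence $\langle P_m:m\in\omega\rangle$ of nonempty perfect subsets of $2^\omega$ and let $T^*_m=\{z\upharpoonright k: z\in P_m+P_m,\ k\in\omega\}$, where $P_m+P_m=\{x+y:x,y\in P_m\}$. A tree mapping with domain $n\ge 1$ consists of a tree ordering $\prec$ on $\{0,\dots,n-1\}$ (a partial order in which the predecessors of each element are linearly ordered) such that $k\prec\ell$ implies $k<\ell$, together with a function $\pi$ into $\omega$ defined exactly on the pairs $(k,\ell)$ such that $k$ is the immediate $\prec$-predecessor of $\ell$. A finite sequence $s$ is acceptable if $\mathrm{dom}(s)=n_i$ for some $i$ and $s\upharpoonright[n_j,n_{j+1})\in C_j$ for all $j<i$. $S$ is the set of all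 tuples $\rho=\langle\pi,s_0,\dots,s_{n-1}\rangle$ with $n\ge1$, $\pi$ a tree mapping with domain $n$, all $s_k$ acceptable with a common domain $n_i$ where $n_i\ge n$, and $s_k+s_\ell\in T^*_{\pi(k,\ell)}$ whenever $\pi(k,\ell)$ is defined; write $n(\rho)=n$, $i(\rho)=i$. For such $\rho$, $U(\rho)$ is the set of all $x_0\in H$ for which there exist $x_1,\dots,x_{n-1}\in H$ with $s_k\vartriangleleft x_k$ for all $k<n$ and $\langle\pi,x_0\upharpoonright n_j,\dots,x_{n-1}\upharpoonright n_j\rangle\in S$ for every $j>i(\rho)$. The family $\{U(\rho):\rho\in S\}$ is a basis of a topology on $H$; $\tau$ denotes this topology. -}

module Defs where

open import Data.Nat using (ℕ; zero; suc; _+_; _∸_; _≤_; _<_)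
open import Data.Bool using (Bool; true; false; _xor_)
open import Data.Fin using (Fin; toℕ) renaming (_<_ to _<ᶠ_)
open import Data.Vec using (Vec; []; _∷_; tabulate; zipWith)
import Data.Vec.Functional as VF
open import Data.Product using (Σ; ∃; ∃₂; _×_; _,_)
open import Data.Sum using (_⊎_)
open import Relation.Nullary using (¬_)
open import Relation.Binary.PropositionalEquality using (_≡_)

Cantor : Set
Cantor = ℕ → Bool

Subset : Set₁
Subset = Cantor → Set

_⊆_ : Subset → Subset → Set
A ⊆ B = ∀ x → A x → B x

_≐_ : Subset → Subset → Set
A ≐ B = (A ⊆ B) × (B ⊆ A)

_⊕_ : ∀ {m} → Vec Bool m → Vec Bool m → Vec Bool m
s ⊕ t = zipWith _xor_ s t

prefix : Cantor → (k : ℕ) → Vec Bool k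
prefix x k = tabulate (λ j → x (toℕ j))

-- lookup in a finite sequence by a natural number (false out of range; only
-- ever used in range below)
lookupℕ : ∀ {m} → Vec Bool m → ℕ → Bool
lookupℕ []       _       = false
lookupℕ (b ∷ s)  zero    = b
lookupℕ (b ∷ s)  (suc j) = lookupℕ s j

ProdOpen : Subset → Set
ProdOpen O = ∀ x → O x → ∃ λ k → ∀ y → prefix y k ≡ prefix x k → O y

Closed : Subset → Set
Closed P = ∀ x → (∀ k → ∃ λ y → P y × prefix y k ≡ prefix x k) → P x

NonemptyPerfect : Subset → Set
NonemptyPerfect P =
  (∃ λ x → P x) × Closed P ×
  (∀ x → P x → ∀ k → ∃ λ y → P y × prefix y k ≡ prefix x k × ∃ λ j → ¬ (y j ≡ x j))

data Borel (H : Subset) (Op : Subset → Set₁) : Subset → Set₁ where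
  bopen  : ∀ {A} → Op A → Borel H Op A
  bcompl : ∀ {A} → Borel H Op A → Borel H Op (λ x → H x × ¬ A x)
  bunion : (f : ℕ → Subset) → (∀ k → Borel H Op (f k)) →
           Borel H Op (λ x → Σ ℕ λ k → f k x)
  bext   : ∀ {A B} → Borel H Op A → A ≐ B → Borel H Op B

Imm : ∀ {n} → (Fin n → Fin n → Bool) → Fin n → Fin n → Set
Imm _≺_ k l = (k ≺ l ≡ true) × ¬ (∃ λ m → (k ≺ m ≡ true) × (m ≺ l ≡ true))

record TreeMapping (n : ℕ) : Set where
  field
    _≺_   : Fin n → Fin n → Bool
    irrefl : ∀ k → k ≺ k ≡ false
    trans  : ∀ a b c → a ≺ b ≡ true → b ≺ c ≡ true → a ≺ c ≡ true
    linear : ∀ a b l → a ≺ l ≡ true → b ≺ l ≡ true →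
             (a ≺ b ≡ true) ⊎ (a ≡ b) ⊎ (b ≺ a ≡ true)
    mono   : ∀ k l → k ≺ l ≡ true → k <ᶠ l
    π      : (k l : Fin n) → Imm _≺_ k l → ℕ

module Setup
  (nn : ℕ → ℕ)
  (C  : (i : ℕ) → Vec Bool (nn (suc i) ∸ nn i) → Set)
  (P  : ℕ → Subset)
  where

  Block : ℕ → Set
  Block i = Vec Bool (nn (suc i) ∸ nn i)

  restrict : Cantor → (i : ℕ) → Block i
  restrict x i = tabulate (λ k → x (nn i + toℕ k))

  blockV : ∀ {m} → Vec Bool m → (j : ℕ) → Block j
  blockV s j = tabulate (λ k → lookupℕ s (nn j + toℕ k))

  H : Subset
  H x = ∀ i → C i (restrict x i)

  Acceptable : (i : ℕ) → Vec Bool (nn i) → Set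
  Acceptable i s = ∀ j → j < i → C j (blockV s j)

  -- T*_m, as a predicate on finite sequences of any length
  TStar : ℕ → ∀ {k} → Vec Bool k → Set
  TStar m {k} t =
    ∃ λ z → (∃₂ λ x y → P m x × P m y × (∀ j → z j ≡ (x j xor y j)))
          × prefix z k ≡ t

  -- raw tuples ⟨π, s_0, …, s_{n-1}⟩ with n = suc n' and common domain n_i
  record Raw : Set where
    field
      n'   : ℕ
      tm   : TreeMapping (suc n')
      i    : ℕ
      seqs : Fin (suc n') → Vec Bool (nn i)

  InS : (n' : ℕ) → TreeMapping (suc n') → (j : ℕ) →
        (Fin (suc n') → Vec Bool (nn j)) → Set
  InS n' tm j ss =
    (suc n' ≤ nn j) × (∀ k → Acceptable j (ss k)) ×
    (∀ k l (p : Imm (TreeMapping._≺_ tm) k l) →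
       TStar (TreeMapping.π tm k l p) (ss k ⊕ ss l))

  S : Set
  S = Σ Raw λ r → InS (Raw.n' r) (Raw.tm r) (Raw.i r) (Raw.seqs r)

  U : S → Subset
  U (r , _) x₀ =
    ∃ λ (xs : Fin (Raw.n' r) → Cantor) →
      let ys = x₀ VF.∷ xs in
      (∀ k → H (ys k)) ×
      (∀ k → prefix (ys k) (nn (Raw.i r)) ≡ Raw.seqs r k) ×
      (∀ j → Raw.i r < j →
         InS (Raw.n' r) (Raw.tm r) j (λ k → prefix (ys k) (nn j)))

  τOpen : Subset → Set₁
  τOpen A = ∃ λ (F : S → Set) → A ≐ (λ x → ∃ λ ρ → F ρ × U ρ x)

  RelOpen : Subset → Set₁
  RelOpen A = ∃ λ O → ProdOpen O × (A ≐ (λ x → O x × H x))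

  NHyp : Set
  NHyp = (nn 0 ≡ 0) × (∀ i → nn i < nn (suc i))

  CHyp : Set
  CHyp = ∀ i (s : Fin (suc (nn i)) → Block i) →
    (∃ λ u → ∀ k → ∃ λ c → C i c × u ≡ (c ⊕ s k)) ×
    (∃ λ u → ∀ k → ∃ λ c → ¬ C i c × u ≡ (c ⊕ s k))

  PHyp : Set
  PHyp = ∀ m → NonemptyPerfect (P m)

-- Around a point x of H, the one-point tuple ⟨∅, x ↾ n_i⟩ (the tree mapping with a
-- single node, so no T*-constraints) is in S, and its basic set U consists of the points
-- of H extending x ↾ n_i.  Since n_i ≥ i, every product-open neighbourhood of x in H
-- therefore contains a τ-basic one; the Borel part follows because Borel sets are
-- monotone in the family of open sets that generates them.
module Submission where

open import Defs
open import Data.Nat using (ℕ; zero; suc; _+_; _∸_; _≤_; _<_; z≤n; s≤s)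
open import Data.Nat.Properties
  using (≤-refl; ≤-trans; <⇒≤; n≤1+n; m≤n⇒m<n∨m≡n; m+[n∸m]≡n; +-monoʳ-<; module ≤-Reasoning)
open import Data.Bool using (Bool; false)
open import Data.Fin using (Fin; toℕ) renaming (zero to fzero)
open import Data.Fin.Properties using (toℕ<n)
open import Data.Vec using (Vec; tabulate)
open import Data.Vec.Properties using (tabulate-cong)
import Data.Vec.Functional as VF
open import Data.Product using (∃; _×_; _,_; proj₁; proj₂)
open import Data.Sum using (inj₁; inj₂)
open import Relation.Binary.PropositionalEquality using (_≡_; refl; sym; trans; cong; subst)

module _ (f : ℕ → ℕ) (f-increasing : ∀ i → f i < f (suc i)) where

  f-mono-≤ : ∀ {j i} → j ≤ i → f j ≤ f i
  f-mono-≤ {i = zero}  z≤n = ≤-refl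
  f-mono-≤ {i = suc i} j≤1+i with m≤n⇒m<n∨m≡n j≤1+i
  ... | inj₁ (s≤s j≤i) = ≤-trans (f-mono-≤ j≤i) (<⇒≤ (f-increasing i))
  ... | inj₂ refl      = ≤-refl

  n≤f[n] : ∀ i → i ≤ f i
  n≤f[n] zero    = z≤n
  n≤f[n] (suc i) = ≤-trans (s≤s (n≤f[n] i)) (f-increasing i)

  block-index< : ∀ {j i k} → j < i → k < f (suc j) ∸ f j → f j + k < f i
  block-index< {j} {i} {k} j<i k<len = begin-strict
    f j + k                  <⟨ +-monoʳ-< (f j) k<len ⟩
    f j + (f (suc j) ∸ f j)  ≡⟨ m+[n∸m]≡n (<⇒≤ (f-increasing j)) ⟩
    f (suc j)                ≤⟨ f-mono-≤ j<i ⟩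
    f i                      ∎
    where open ≤-Reasoning

lookupℕ-tabulate : ∀ {m} (g : ℕ → Bool) {t} → t < m →
                   lookupℕ {m} (tabulate (λ j → g (toℕ j))) t ≡ g t
lookupℕ-tabulate {suc m} g {zero}  _         = refl
lookupℕ-tabulate {suc m} g {suc t} (s≤s t<m) = lookupℕ-tabulate (λ n → g (suc n)) t<m

lookupℕ-prefix : ∀ x {m t} → t < m → lookupℕ (prefix x m) t ≡ x t
lookupℕ-prefix x = lookupℕ-tabulate x

prefix-≤ : ∀ x y {k m} → k ≤ m → prefix y m ≡ prefix x m → prefix y k ≡ prefix x k
prefix-≤ x y k≤m y↾m≡x↾m = tabulate-cong λ j →
  let t<m = ≤-trans (toℕ<n j) k≤m in
  trans (sym (lookupℕ-prefix y t<m))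
        (trans (cong (λ v → lookupℕ v (toℕ j)) y↾m≡x↾m) (lookupℕ-prefix x t<m))

Borel-mono : ∀ {H Op Op'} → (∀ A → Op A → Op' A) → ∀ {A} → Borel H Op A → Borel H Op' A
Borel-mono Op⊆Op' (bopen o)     = bopen (Op⊆Op' _ o)
Borel-mono Op⊆Op' (bcompl b)    = bcompl (Borel-mono Op⊆Op' b)
Borel-mono Op⊆Op' (bunion g bs) = bunion g (λ k → Borel-mono Op⊆Op' (bs k))
Borel-mono Op⊆Op' (bext b A≐B)  = bext (Borel-mono Op⊆Op' b) A≐B

singletonTreeMapping : TreeMapping 1
singletonTreeMapping = record
  { _≺_    = λ _ _ → false
  ; irrefl = λ _ → refl
  ; trans  = λ { _ _ _ () _ }
  ; linear = λ { _ _ _ () _ }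
  ; mono   = λ { _ _ () }
  ; π      = λ { _ _ (() , _) }
  }

module _ (nn : ℕ → ℕ) (C : (i : ℕ) → Vec Bool (nn (suc i) ∸ nn i) → Set) (P : ℕ → Subset)
         (nhyp : Setup.NHyp nn C P) where

  open Setup nn C P

  private
    nn-increasing : ∀ i → nn i < nn (suc i)
    nn-increasing = proj₂ nhyp

    nn-positive : ∀ {j} → 0 < j → 0 < nn j
    nn-positive {j} 0<j = ≤-trans 0<j (n≤f[n] nn nn-increasing j)

  blockV-prefix : ∀ x {i j} → j < i → blockV (prefix x (nn i)) j ≡ restrict x j
  blockV-prefix x j<i = tabulate-cong λ k →
    lookupℕ-prefix x (block-index< nn nn-increasing j<i (toℕ<n k))

  prefix-acceptable : ∀ x → H x → ∀ i → Acceptable i (prefix x (nn i))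
  prefix-acceptable x x∈H i j j<i = subst (C j) (sym (blockV-prefix x j<i)) (x∈H j)

  singleton-InS : ∀ (ys : Fin 1 → Cantor) → H (ys fzero) → ∀ {j} → 1 ≤ nn j →
                  InS 0 singletonTreeMapping j (λ k → prefix (ys k) (nn j))
  singleton-InS ys y∈H 1≤nn =
    1≤nn , (λ { fzero → prefix-acceptable (ys fzero) y∈H _ }) , λ { _ _ (() , _) }

  -- the index suc k guarantees both n_i ≥ k and n_i ≥ 1
  cylinderBasic : ∀ x → H x → ℕ → S
  cylinderBasic x x∈H k =
    record { n' = 0 ; tm = singletonTreeMapping ; i = suc k ; seqs = λ _ → prefix x (nn (suc k)) }
    , singleton-InS (λ _ → x) x∈H (nn-positive (s≤s z≤n))

  cylinderBasic-∋ : ∀ x (x∈H : H x) k → U (cylinderBasic x x∈H k) x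
  cylinderBasic-∋ x x∈H k =
    (λ ()) , (λ { fzero → x∈H }) , (λ { fzero → refl }) ,
    λ j k<j → singleton-InS (x VF.∷ λ ()) x∈H (nn-positive (≤-trans (s≤s z≤n) k<j))

  cylinderBasic-⊆ : ∀ x (x∈H : H x) k {y} → U (cylinderBasic x x∈H k) y →
                    prefix y k ≡ prefix x k × H y
  cylinderBasic-⊆ x x∈H k {y} (_ , ys∈H , ys↾≡ , _) =
    prefix-≤ x y (≤-trans (n≤1+n k) (n≤f[n] nn nn-increasing (suc k))) (ys↾≡ fzero) , ys∈H fzero

  RelOpen⇒τOpen : ∀ A → RelOpen A → τOpen A
  RelOpen⇒τOpen A (O , O-open , A⊆O∩H , O∩H⊆A) =
    (λ ρ → U ρ ⊆ A) , covered , λ x (_ , Uρ⊆A , x∈Uρ) → Uρ⊆A x x∈Uρ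
    where
    covered : A ⊆ (λ x → ∃ λ ρ → (U ρ ⊆ A) × U ρ x)
    covered x x∈A = cylinderBasic x x∈H k , Uρ⊆A , cylinderBasic-∋ x x∈H k
      where
      x∈O = proj₁ (A⊆O∩H x x∈A)
      x∈H = proj₂ (A⊆O∩H x x∈A)
      k = proj₁ (O-open x x∈O)
      Uρ⊆A : U (cylinderBasic x x∈H k) ⊆ A
      Uρ⊆A y y∈Uρ =
        let y↾k≡x↾k , y∈H = cylinderBasic-⊆ x x∈H k y∈Uρ in
        O∩H⊆A y (proj₂ (O-open x x∈O) y y↾k≡x↾k , y∈H)

proposition2p5 :
    (nn : ℕ → ℕ) (C : (i : ℕ) → Vec Bool (nn (suc i) ∸ nn i) → Set) (P : ℕ → Subset) →
    Setup.NHyp nn C P → Setup.CHyp nn C P → Setup.PHyp nn C P →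
    (∀ A → Setup.RelOpen nn C P A → Setup.τOpen nn C P A) ×
    (∀ A → A ⊆ Setup.H nn C P →
      Borel (Setup.H nn C P) (Setup.RelOpen nn C P) A →
      Borel (Setup.H nn C P) (Setup.τOpen nn C P) A)
proposition2p5 nn C P nhyp _ _ =
  RelOpen⇒τOpen nn C P nhyp , λ _ _ → Borel-mono (RelOpen⇒τOpen nn C P nhyp)
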